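{- Every partial plane spread $\mathcal{S}$ of size $17$ in $\mathrm{PG}(6,2)$ contains a $5$-configuration.
   Context: A partial plane spread is a set of $3$-dimensional subspaces (blocks) of $\mathbb{F}_2^7$ pairwise intersecting in $\{0\}$. A $5$-configuration is a set $\mathcal{T}$ of $5$ pairwise trivially intersecting $3$-dimensional subspaces of $\mathbb{F}_2^7$ such that there exist two distinct hyperplanes ($6$-dimensional subspaces) $H_1\ne H_2$ each containing $3$ elements of $\mathcal{T}$. -}

module Defs where

open import Data.Bool using (Bool; true; false; _xor_)
open import Data.Nat using (ℕ)
open import Data.Fin using (Fin)
open import Data.Vec using (Vec; []; _∷_; zipWith; replicate)
open import Data.Product using (Σ; ∃; _×_; _,_)
open import Relation.Binary.PropositionalEquality using (_≡_; _≢_)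
open import Relation.Nullary using (¬_)
open import Function.Definitions using (Injective)

-- Vectors of F₂ⁿ (Bool with xor as addition, 'and' as multiplication)
Vect : ℕ → Set
Vect n = Vec Bool n

0v : ∀ {n} → Vect n
0v = replicate _ false

_⊕_ : ∀ {n} → Vect n → Vect n → Vect n
_⊕_ = zipWith _xor_

lincomb : ∀ {n k} → Vec Bool k → Vec (Vect n) k → Vect n
lincomb [] [] = 0v
lincomb (true ∷ cs) (b ∷ bs) = b ⊕ lincomb cs bs
lincomb (false ∷ cs) (b ∷ bs) = lincomb cs bs

LinIndep : ∀ {n k} → Vec (Vect n) k → Set
LinIndep {k = k} bs = ∀ (c : Vec Bool k) → lincomb c bs ≡ 0v → c ≡ replicate k false

record Subspace (n k : ℕ) : Set where
  constructor subspace
  field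
    basis : Vec (Vect n) k
    indep : LinIndep basis
open Subspace public

_∈S_ : ∀ {n k} → Vect n → Subspace n k → Set
_∈S_ {k = k} x U = ∃ λ (c : Vec Bool k) → lincomb c (basis U) ≡ x

_⊆S_ : ∀ {n k m} → Subspace n k → Subspace n m → Set
U ⊆S W = ∀ x → x ∈S U → x ∈S W

_≈S_ : ∀ {n k m} → Subspace n k → Subspace n m → Set
U ≈S W = (U ⊆S W) × (W ⊆S U)

TrivInter : ∀ {n k m} → Subspace n k → Subspace n m → Set
TrivInter U W = ∀ x → x ∈S U → x ∈S W → x ≡ 0v

Block : Set
Block = Subspace 7 3

Hyperplane : Set
Hyperplane = Subspace 7 6

-- A partial plane spread of size s: s blocks (indexed by Fin s) pairwise intersecting in {0}.
-- (Pairwise trivial intersection of nonzero subspaces forces the s blocks to be distinct.)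
IsPartialPlaneSpread : ∀ {s} → (Fin s → Block) → Set
IsPartialPlaneSpread {s} S = ∀ (i j : Fin s) → i ≢ j → TrivInter (S i) (S j)

Contains3 : Hyperplane → (Fin 5 → Block) → Set
Contains3 H T = ∃ λ (g : Fin 3 → Fin 5) → Injective _≡_ _≡_ g × (∀ a → T (g a) ⊆S H)

Is5Configuration : (Fin 5 → Block) → Set
Is5Configuration T =
  IsPartialPlaneSpread T ×
  (∃ λ (H₁ : Hyperplane) → ∃ λ (H₂ : Hyperplane) →
     ¬ (H₁ ≈S H₂) × Contains3 H₁ T × Contains3 H₂ T)

Contains5Configuration : ∀ {s} → (Fin s → Block) → Set
Contains5Configuration {s} S =
  ∃ λ (f : Fin 5 → Fin s) → Injective _≡_ _≡_ f × Is5Configuration (λ a → S (f a))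

-- Hyperplanes of F₂⁷ are the kernels a⊥ of the 127 nonzero vectors a. Counting points shows
-- that a plane lies in 15 hyperplanes, that two disjoint planes lie in exactly one common
-- hyperplane, and, since the 17 blocks have disjoint point sets, that a hyperplane contains at
-- most 3 blocks. Writing A(a) for the number of blocks in a⊥, ∑ A = 17·15 = 255 and
-- ∑ A² = 17·15 + 17·16 = 527, so A ≤ 3 forces at least 6 hyperplanes with A = 3. These carry
-- 18 > 17 incidences with blocks, so some block i lies in two of them, a⊥ and a'⊥. Their other
-- blocks p, q and r, s are four further distinct blocks, and p, q, i, r, s form a 5-configuration
-- with the hyperplanes a⊥ = ⟨p, i⟩ and a'⊥ = ⟨i, r⟩.
module Submission where

open import Defs
open import Algebra using (CommutativeRing)
import Algebra.Properties.CommutativeSemigroup as CommutativeSemigroupProperties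
open import Data.Bool using (Bool; true; false; _xor_; not; _∧_)
open import Data.Bool.Properties
  using (xor-∧-commutativeRing; xor-assoc; xor-comm; xor-same; xor-identityˡ; xor-identityʳ)
  renaming (_≟_ to _≟ᵇ_)
open import Data.Fin using (Fin; zero; suc; _↑ˡ_; _↑ʳ_)
open import Data.Fin.Properties using (↑ˡ-injective; ↑ʳ-injective) renaming (_≟_ to _≟ᶠ_)
open import Data.List using (List; []; _∷_; _++_; map; filter; length; allFin; cartesianProduct)
open import Data.List.Membership.Propositional using (_∈_)
open import Data.List.Membership.Propositional.Properties
  using (∈-map⁺; ∈-map⁻; ∈-filter⁺; ∈-filter⁻; ∈-++⁺ˡ; ∈-++⁺ʳ; ∈-allFin; ∈-cartesianProduct⁻)
open import Data.List.Relation.Unary.All as All using (All; all?; [])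
open import Data.List.Relation.Unary.AllPairs using ([]; _∷_)
open import Data.List.Relation.Unary.Any using (here; there)
open import Data.List.Relation.Unary.Unique.Propositional using (Unique)
import Data.List.Relation.Unary.Unique.Propositional.Properties as Unique
open import Data.Nat using (ℕ; zero; suc; _+_; _*_; _≤_; _<_; z≤n; s≤s; z<s; s≤s⁻¹; _≟_)
open import Data.Nat.Properties
open import Data.Nat.Tactic.RingSolver using (solve-∀)
open import Data.Product using (∃; ∃₂; Σ; _×_; _,_; proj₂; uncurry)
open import Data.Sum using (inj₁; inj₂)
open import Data.Vec as Vec using (Vec; []; _∷_; replicate)
open import Data.Vec.Properties
  using (≡-dec; zipWith-assoc; zipWith-comm; zipWith-identityˡ; zipWith-identityʳ; ∷-injectiveʳ; map-++)
open import Data.Vec.Relation.Unary.All using ([]; _∷_)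
open import Data.Vec.Relation.Unary.All.Properties using (lookup⁺)
open import Data.Vec.Relation.Unary.AllPairs using (AllPairs; []; _∷_)
open import Function using (_∘_)
open import Function.Definitions using (Injective)
open import Relation.Binary.Definitions using (DecidableEquality)
open import Relation.Binary.PropositionalEquality
open import Relation.Nullary using (Dec; yes; no; does; ¬_; ¬?; contradiction)
open import Relation.Nullary.Decidable using (dec-true; dec-false; toWitness; map′)

private
  variable
    A B P : Set
    k m n : ℕ

open CommutativeRing xor-∧-commutativeRing using ()
  renaming (+-commutativeSemigroup to xor-commutativeSemigroup; distribˡ to ∧-distribˡ-xor)
open CommutativeSemigroupProperties xor-commutativeSemigroup using () renaming (interchange to xor-interchange)
open CommutativeSemigroupProperties +-commutativeSemigroup using () renaming (interchange to +-interchange)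

-- Finite sums

𝟙 : Bool → ℕ
𝟙 true  = 1
𝟙 false = 0

𝟙≤1 : ∀ b → 𝟙 b ≤ 1
𝟙≤1 true  = s≤s z≤n
𝟙≤1 false = z≤n

𝟙-does-positive : (d : Dec P) → 0 < 𝟙 (does d) → P
𝟙-does-positive (yes p) _ = p

𝟙-not-does-positive : (d : Dec P) → 0 < 𝟙 (not (does d)) → ¬ P
𝟙-not-does-positive (no ¬p) _ = ¬p

𝟙*𝟙 : ∀ b → 𝟙 b * 𝟙 b ≡ 𝟙 b
𝟙*𝟙 true  = refl
𝟙*𝟙 false = refl

*-positive⁻ : ∀ m n → 0 < m * n → 0 < m × 0 < n
*-positive⁻ (suc m) (suc n) _ = z<s , z<s
*-positive⁻ (suc m) zero 0<m*0 = contradiction (subst (0 <_) (*-zeroʳ m) 0<m*0) λ ()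

∑ : List A → (A → ℕ) → ℕ
∑ []       g = 0
∑ (x ∷ xs) g = g x + ∑ xs g

syntax ∑ L (λ x → g) = ∑[ x ∈ L ] g

∑-cong : ∀ (L : List A) {g h : A → ℕ} → (∀ {x} → x ∈ L → g x ≡ h x) → ∑ L g ≡ ∑ L h
∑-cong []      _   = refl
∑-cong (x ∷ L) g≡h = cong₂ _+_ (g≡h (here refl)) (∑-cong L (g≡h ∘ there))

∑-mono-≤ : ∀ (L : List A) {g h : A → ℕ} → (∀ {x} → x ∈ L → g x ≤ h x) → ∑ L g ≤ ∑ L h
∑-mono-≤ []      _   = z≤n
∑-mono-≤ (x ∷ L) g≤h = +-mono-≤ (g≤h (here refl)) (∑-mono-≤ L (g≤h ∘ there))

∑-const : ∀ (L : List A) c → ∑[ _ ∈ L ] c ≡ length L * c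
∑-const []      c = refl
∑-const (x ∷ L) c = cong (c +_) (∑-const L c)

∑-zero : ∀ (L : List A) → ∑[ _ ∈ L ] 0 ≡ 0
∑-zero L = trans (∑-const L 0) (*-zeroʳ (length L))

∑-distrib-+ : ∀ (L : List A) (g h : A → ℕ) → ∑[ x ∈ L ] (g x + h x) ≡ ∑ L g + ∑ L h
∑-distrib-+ []      g h = refl
∑-distrib-+ (x ∷ L) g h =
  trans (cong (g x + h x +_) (∑-distrib-+ L g h)) (+-interchange (g x) (h x) (∑ L g) (∑ L h))

∑-distribˡ-* : ∀ (L : List A) c (g : A → ℕ) → ∑[ x ∈ L ] (c * g x) ≡ c * ∑ L g
∑-distribˡ-* []      c g = sym (*-zeroʳ c)
∑-distribˡ-* (x ∷ L) c g =
  trans (cong (c * g x +_) (∑-distribˡ-* L c g)) (sym (*-distribˡ-+ c (g x) (∑ L g)))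

∑-distribʳ-* : ∀ (L : List A) c (g : A → ℕ) → ∑[ x ∈ L ] (g x * c) ≡ ∑ L g * c
∑-distribʳ-* L c g =
  trans (∑-cong L (λ {x} _ → *-comm (g x) c)) (trans (∑-distribˡ-* L c g) (*-comm c (∑ L g)))

∑-affine : ∀ (L : List A) k c (g : A → ℕ) → ∑[ x ∈ L ] (k + c * g x) ≡ length L * k + c * ∑ L g
∑-affine L k c g = trans (∑-distrib-+ L _ _) (cong₂ _+_ (∑-const L k) (∑-distribˡ-* L c g))

∑-comm : ∀ (L : List A) (M : List B) (F : A → B → ℕ) → ∑[ x ∈ L ] ∑[ y ∈ M ] F x y ≡ ∑[ y ∈ M ] ∑[ x ∈ L ] F x y
∑-comm []      M F = sym (∑-zero M)
∑-comm (x ∷ L) M F = trans (cong (∑ M (F x) +_) (∑-comm L M F)) (sym (∑-distrib-+ M (F x) _))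

∑*∑ : ∀ (L : List A) (M : List B) (g : A → ℕ) (h : B → ℕ) → ∑ L g * ∑ M h ≡ ∑[ x ∈ L ] ∑[ y ∈ M ] (g x * h y)
∑*∑ L M g h =
  trans (sym (∑-distribʳ-* L (∑ M h) g)) (∑-cong L (λ {x} _ → sym (∑-distribˡ-* M (g x) h)))

∑-++ : ∀ (L M : List A) (g : A → ℕ) → ∑ (L ++ M) g ≡ ∑ L g + ∑ M g
∑-++ []      M g = refl
∑-++ (x ∷ L) M g = trans (cong (g x +_) (∑-++ L M g)) (sym (+-assoc (g x) _ _))

∑-map : ∀ (f : A → B) L (g : B → ℕ) → ∑ (map f L) g ≡ ∑[ x ∈ L ] g (f x)
∑-map f []      g = refl
∑-map f (x ∷ L) g = cong (g (f x) +_) (∑-map f L g)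

∑-cartesianProduct : ∀ (L : List A) (M : List B) (g : A × B → ℕ) →
                     ∑ (cartesianProduct L M) g ≡ ∑[ x ∈ L ] ∑[ y ∈ M ] g (x , y)
∑-cartesianProduct []      M g = refl
∑-cartesianProduct (x ∷ L) M g =
  trans (∑-++ (map (x ,_) M) _ g) (cong₂ _+_ (∑-map (x ,_) M g) (∑-cartesianProduct L M g))

term≤∑ : ∀ {L : List A} (g : A → ℕ) {x} → x ∈ L → g x ≤ ∑ L g
term≤∑ g (here refl) = m≤m+n _ _
term≤∑ {L = y ∷ L} g (there x∈L) = ≤-trans (term≤∑ g x∈L) (m≤n+m _ (g y))

∑-positive : ∀ (L : List A) (g : A → ℕ) → 0 < ∑ L g → ∃ λ x → x ∈ L × 0 < g x
∑-positive (x ∷ L) g 0<∑ with g x in eq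
... | suc _ = x , here refl , subst (0 <_) (sym eq) z<s
... | zero  with y , y∈L , 0<gy ← ∑-positive L g 0<∑ = y , there y∈L , 0<gy

∑-≤1 : ∀ {L : List A} {g : A → ℕ} → Unique L → (∀ {x} → x ∈ L → g x ≤ 1) →
       (∀ {x y} → x ∈ L → y ∈ L → 0 < g x → 0 < g y → x ≡ y) → ∑ L g ≤ 1
∑-≤1 [] _ _ = z≤n
∑-≤1 {L = x ∷ L} {g} (x∉L ∷ L-unique) g≤1 g-injective with g x in eq
... | zero  = ∑-≤1 L-unique (g≤1 ∘ there) (λ p q → g-injective (there p) (there q))
... | suc k = subst (λ s → suc k + s ≤ 1) (sym rest≡0)
                (subst (_≤ 1) (trans eq (sym (+-identityʳ (suc k)))) (g≤1 (here refl)))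
  where
  rest≡0 : ∑ L g ≡ 0
  rest≡0 = trans (∑-cong L (λ y∈L → n≤0⇒n≡0 (≮⇒≥ λ 0<gy →
             All.lookup x∉L y∈L (g-injective (here refl) (there y∈L) (subst (0 <_) (sym eq) z<s) 0<gy))))
           (∑-zero L)

∑≥2⇒two-positive : ∀ {L : List A} {g : A → ℕ} → Unique L → (∀ {x} → x ∈ L → g x ≤ 1) → 2 ≤ ∑ L g →
                   ∃₂ λ x y → x ∈ L × y ∈ L × x ≢ y × 0 < g x × 0 < g y
∑≥2⇒two-positive {L = x ∷ L} {g} (x∉L ∷ L-unique) g≤1 2≤∑ with g x in eq
... | zero with y , z , y∈L , z∈L , y≢z , 0<gy , 0<gz ← ∑≥2⇒two-positive L-unique (g≤1 ∘ there) 2≤∑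
  = y , z , there y∈L , there z∈L , y≢z , 0<gy , 0<gz
... | suc k with y , y∈L , 0<gy ← ∑-positive L g
                   (+-cancelˡ-≤ 1 1 (∑ L g) (≤-trans 2≤∑ (+-monoˡ-≤ (∑ L g) (subst (_≤ 1) eq (g≤1 (here refl))))))
  = x , y , here refl , there y∈L , All.lookup x∉L y∈L , subst (0 <_) (sym eq) z<s , 0<gy

two-positive⇒∑≥2 : ∀ {L : List A} {g : A → ℕ} {x y} → Unique L → x ∈ L → y ∈ L → x ≢ y →
                   0 < g x → 0 < g y → 2 ≤ ∑ L g
two-positive⇒∑≥2 _ (here refl) (here refl) x≢y _ _ = contradiction refl x≢y
two-positive⇒∑≥2 {g = g} _ (here refl) (there y∈L) _ 0<gx 0<gy = +-mono-≤ 0<gx (≤-trans 0<gy (term≤∑ g y∈L))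
two-positive⇒∑≥2 {L = z ∷ L} {g} _ (there x∈L) (here refl) _ 0<gx 0<gy =
  subst (2 ≤_) (+-comm (∑ L g) (g z)) (+-mono-≤ (≤-trans 0<gx (term≤∑ g x∈L)) 0<gy)
two-positive⇒∑≥2 {L = z ∷ L} {g} (_ ∷ L-unique) (there x∈L) (there y∈L) x≢y 0<gx 0<gy =
  ≤-trans (two-positive⇒∑≥2 L-unique x∈L y∈L x≢y 0<gx 0<gy) (m≤n+m _ (g z))

pigeonhole : ∀ (L : List A) (g : A → ℕ) → length L < ∑ L g → ∃ λ x → x ∈ L × 2 ≤ g x
pigeonhole (x ∷ L) g len<∑ with g x in eq
... | suc (suc _) = x , here refl , subst (2 ≤_) (sym eq) (s≤s (s≤s z≤n))
... | suc zero with y , y∈L , 2≤gy ← pigeonhole L g (s≤s⁻¹ len<∑) = y , there y∈L , 2≤gy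
... | zero     with y , y∈L , 2≤gy ← pigeonhole L g (≤-trans (n≤1+n _) len<∑) = y , there y∈L , 2≤gy

∑-≤-≡⇒≡ : ∀ (L : List A) {g h : A → ℕ} → (∀ {x} → x ∈ L → g x ≤ h x) → ∑ L g ≡ ∑ L h →
          ∀ {x} → x ∈ L → g x ≡ h x
∑-≤-≡⇒≡ (y ∷ L) {g} {h} g≤h ∑≡∑ x∈ with m≤n⇒m<n∨m≡n (g≤h (here refl))
... | inj₁ gy<hy = contradiction ∑≡∑ (<⇒≢ (+-mono-<-≤ gy<hy (∑-mono-≤ L (g≤h ∘ there))))
... | inj₂ gy≡hy with x∈
...   | here refl = gy≡hy
...   | there x∈L =
  ∑-≤-≡⇒≡ L (g≤h ∘ there) (+-cancelˡ-≡ (g y) _ _ (trans ∑≡∑ (cong (_+ ∑ L h) (sym gy≡hy)))) x∈L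

∑-sift : (_≟ᴬ_ : DecidableEquality A) {L : List A} → Unique L → ∀ {x} → x ∈ L → ∀ (g : A → ℕ) →
         ∑[ y ∈ L ] (𝟙 (does (x ≟ᴬ y)) * g y) ≡ g x
∑-sift _≟ᴬ_ {x ∷ L} (x∉L ∷ _) (here refl) g rewrite dec-true (x ≟ᴬ x) refl =
  trans (cong (g x + 0 +_) rest≡0) (trans (+-identityʳ _) (+-identityʳ (g x)))
  where
  rest≡0 : ∑[ y ∈ L ] (𝟙 (does (x ≟ᴬ y)) * g y) ≡ 0
  rest≡0 = trans (∑-cong L (λ y∈L → cong (λ b → 𝟙 b * g _) (dec-false (x ≟ᴬ _) (All.lookup x∉L y∈L))))
                 (∑-zero L)
∑-sift _≟ᴬ_ {y ∷ L} (y∉L ∷ L-unique) {x} (there x∈L) g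
  rewrite dec-false (x ≟ᴬ y) (λ x≡y → All.lookup y∉L x∈L (sym x≡y)) = ∑-sift _≟ᴬ_ L-unique x∈L g

∑-remove : (_≟ᴬ_ : DecidableEquality A) {L : List A} → Unique L → ∀ {x} → x ∈ L → ∀ (g : A → ℕ) →
           ∑ L g ≡ g x + ∑[ y ∈ L ] (𝟙 (not (does (x ≟ᴬ y))) * g y)
∑-remove _≟ᴬ_ {L} L-unique {x} x∈L g = begin
  ∑ L g
    ≡⟨ ∑-cong L (λ {y} _ → split (does (x ≟ᴬ y)) (g y)) ⟩
  ∑[ y ∈ L ] (𝟙 (does (x ≟ᴬ y)) * g y + 𝟙 (not (does (x ≟ᴬ y))) * g y)
    ≡⟨ ∑-distrib-+ L _ _ ⟩
  ∑[ y ∈ L ] (𝟙 (does (x ≟ᴬ y)) * g y) + ∑[ y ∈ L ] (𝟙 (not (does (x ≟ᴬ y))) * g y)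
    ≡⟨ cong (_+ ∑[ y ∈ L ] (𝟙 (not (does (x ≟ᴬ y))) * g y)) (∑-sift _≟ᴬ_ L-unique x∈L g) ⟩
  g x + ∑[ y ∈ L ] (𝟙 (not (does (x ≟ᴬ y))) * g y) ∎
  where
  open ≡-Reasoning
  split : ∀ b n → n ≡ 𝟙 b * n + 𝟙 (not b) * n
  split true  n = sym (trans (+-identityʳ (n + 0)) (+-identityʳ n))
  split false n = sym (+-identityʳ n)

lookup-injective : ∀ {xs : Vec A n} → AllPairs _≢_ xs → Injective _≡_ _≡_ (Vec.lookup xs)
lookup-injective (_  ∷ _)   {zero}  {zero}  _  = refl
lookup-injective (x≢ ∷ _)   {zero}  {suc v} eq = contradiction eq (lookup⁺ x≢ v)
lookup-injective (x≢ ∷ _)   {suc u} {zero}  eq = contradiction (sym eq) (lookup⁺ x≢ u)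
lookup-injective (_  ∷ xs≢) {suc u} {suc v} eq = cong suc (lookup-injective xs≢ eq)

-- Vectors over F₂

_≟ᵛ_ : DecidableEquality (Vect n)
_≟ᵛ_ = ≡-dec _≟ᵇ_

⊕-assoc : ∀ (x y z : Vect n) → (x ⊕ y) ⊕ z ≡ x ⊕ (y ⊕ z)
⊕-assoc = zipWith-assoc xor-assoc

⊕-comm : ∀ (x y : Vect n) → x ⊕ y ≡ y ⊕ x
⊕-comm = zipWith-comm xor-comm

⊕-identityˡ : ∀ (x : Vect n) → 0v ⊕ x ≡ x
⊕-identityˡ = zipWith-identityˡ xor-identityˡ

⊕-identityʳ : ∀ (x : Vect n) → x ⊕ 0v ≡ x
⊕-identityʳ = zipWith-identityʳ xor-identityʳ

⊕-self : ∀ (x : Vect n) → x ⊕ x ≡ 0v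
⊕-self []       = refl
⊕-self (x ∷ xs) = cong₂ _∷_ (xor-same x) (⊕-self xs)

⊕-interchange : ∀ (w x y z : Vect n) → (w ⊕ x) ⊕ (y ⊕ z) ≡ (w ⊕ y) ⊕ (x ⊕ z)
⊕-interchange []       []       []       []       = refl
⊕-interchange (w ∷ ws) (x ∷ xs) (y ∷ ys) (z ∷ zs) =
  cong₂ _∷_ (xor-interchange w x y z) (⊕-interchange ws xs ys zs)

⊕≡0v⇒≡ : ∀ (x y : Vect n) → x ⊕ y ≡ 0v → x ≡ y
⊕≡0v⇒≡ x y x⊕y≡0 = begin
  x             ≡⟨ sym (⊕-identityʳ x) ⟩
  x ⊕ 0v        ≡⟨ cong (x ⊕_) (sym (⊕-self y)) ⟩
  x ⊕ (y ⊕ y)   ≡⟨ sym (⊕-assoc x y y) ⟩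
  (x ⊕ y) ⊕ y   ≡⟨ cong (_⊕ y) x⊕y≡0 ⟩
  0v ⊕ y        ≡⟨ ⊕-identityˡ y ⟩
  y             ∎
  where open ≡-Reasoning

infix 7 _·_

_·_ : Vect n → Vect n → Bool
[]       · []       = false
(a ∷ as) · (x ∷ xs) = (a ∧ x) xor (as · xs)

·-zeroˡ : ∀ (x : Vect n) → 0v · x ≡ false
·-zeroˡ []       = refl
·-zeroˡ (x ∷ xs) = ·-zeroˡ xs

·-zeroʳ : ∀ (a : Vect n) → a · 0v ≡ false
·-zeroʳ []           = refl
·-zeroʳ (true  ∷ as) = ·-zeroʳ as
·-zeroʳ (false ∷ as) = ·-zeroʳ as

·-distribˡ-⊕ : ∀ (a x y : Vect n) → a · (x ⊕ y) ≡ (a · x) xor (a · y)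
·-distribˡ-⊕ []       []       []       = refl
·-distribˡ-⊕ (a ∷ as) (x ∷ xs) (y ∷ ys) =
  trans (cong₂ _xor_ (∧-distribˡ-xor a x y) (·-distribˡ-⊕ as xs ys))
        (xor-interchange (a ∧ x) (a ∧ y) (as · xs) (as · ys))

·-nondegenerate : ∀ (v : Vect n) → (∀ c → c · v ≡ false) → v ≡ 0v
·-nondegenerate []      _        = refl
·-nondegenerate (x ∷ v) c·v≡false = cong₂ _∷_ x≡false (·-nondegenerate v (c·v≡false ∘ (false ∷_)))
  where
  x≡false : x ≡ false
  x≡false = trans (sym (xor-identityʳ x))
                  (trans (cong (x xor_) (sym (·-zeroˡ v))) (c·v≡false (true ∷ 0v)))

·-lincomb : ∀ (a : Vect n) (c : Vec Bool k) B → a · lincomb c B ≡ c · Vec.map (a ·_) B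
·-lincomb a []          []      = ·-zeroʳ a
·-lincomb a (true  ∷ c) (b ∷ B) = trans (·-distribˡ-⊕ a b (lincomb c B)) (cong ((a · b) xor_) (·-lincomb a c B))
·-lincomb a (false ∷ c) (b ∷ B) = ·-lincomb a c B

lincomb-⊕ : ∀ (c d : Vec Bool k) (B : Vec (Vect n) k) → lincomb (c ⊕ d) B ≡ lincomb c B ⊕ lincomb d B
lincomb-⊕ []          []          []      = sym (⊕-self 0v)
lincomb-⊕ (true  ∷ c) (true  ∷ d) (b ∷ B) = begin
  lincomb (c ⊕ d) B                          ≡⟨ lincomb-⊕ c d B ⟩
  lincomb c B ⊕ lincomb d B                  ≡⟨ sym (⊕-identityˡ _) ⟩
  0v ⊕ (lincomb c B ⊕ lincomb d B)           ≡⟨ cong (_⊕ _) (sym (⊕-self b)) ⟩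
  (b ⊕ b) ⊕ (lincomb c B ⊕ lincomb d B)      ≡⟨ ⊕-interchange b b _ _ ⟩
  (b ⊕ lincomb c B) ⊕ (b ⊕ lincomb d B)      ∎
  where open ≡-Reasoning
lincomb-⊕ (true  ∷ c) (false ∷ d) (b ∷ B) =
  trans (cong (b ⊕_) (lincomb-⊕ c d B)) (sym (⊕-assoc b _ _))
lincomb-⊕ (false ∷ c) (true  ∷ d) (b ∷ B) = begin
  b ⊕ lincomb (c ⊕ d) B                      ≡⟨ cong (b ⊕_) (lincomb-⊕ c d B) ⟩
  b ⊕ (lincomb c B ⊕ lincomb d B)            ≡⟨ sym (⊕-assoc b _ _) ⟩
  (b ⊕ lincomb c B) ⊕ lincomb d B            ≡⟨ cong (_⊕ lincomb d B) (⊕-comm b _) ⟩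
  (lincomb c B ⊕ b) ⊕ lincomb d B            ≡⟨ ⊕-assoc _ b _ ⟩
  lincomb c B ⊕ (b ⊕ lincomb d B)            ∎
  where open ≡-Reasoning
lincomb-⊕ (false ∷ c) (false ∷ d) (b ∷ B) = lincomb-⊕ c d B

lincomb-injective : ∀ {B : Vec (Vect n) k} → LinIndep B → ∀ c d → lincomb c B ≡ lincomb d B → c ≡ d
lincomb-injective {B = B} B-indep c d eq = ⊕≡0v⇒≡ c d (B-indep (c ⊕ d)
  (trans (lincomb-⊕ c d B) (trans (cong (_⊕ lincomb d B) eq) (⊕-self _))))

lincomb-++ : ∀ (c : Vec Bool k) (d : Vec Bool m) (B : Vec (Vect n) k) B' →
             lincomb (c Vec.++ d) (B Vec.++ B') ≡ lincomb c B ⊕ lincomb d B'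
lincomb-++ []          d []      B' = sym (⊕-identityˡ _)
lincomb-++ (true  ∷ c) d (b ∷ B) B' = trans (cong (b ⊕_) (lincomb-++ c d B B')) (sym (⊕-assoc b _ _))
lincomb-++ (false ∷ c) d (b ∷ B) B' = lincomb-++ c d B B'

replicate-++ : ∀ k {m} (x : A) → replicate (k + m) x ≡ replicate k x Vec.++ replicate m x
replicate-++ zero    x = refl
replicate-++ (suc k) x = cong (x ∷_) (replicate-++ k x)

-- Subspaces and hyperplanes

-- U lies in the hyperplane a⊥ = {x | a · x ≡ false}.
record _⊥ˢ_ (a : Vect n) (U : Subspace n k) : Set where
  constructor ⊥ˢ-basis
  field basis-⊥ : Vec.map (a ·_) (basis U) ≡ 0v

_⊥ˢ?_ : ∀ (a : Vect n) (U : Subspace n k) → Dec (a ⊥ˢ U)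
a ⊥ˢ? U = map′ ⊥ˢ-basis _⊥ˢ_.basis-⊥ (Vec.map (a ·_) (basis U) ≟ᵛ 0v)

⊥ˢ⇒⊥ : ∀ {a : Vect n} {U : Subspace n k} → a ⊥ˢ U → ∀ {x} → x ∈S U → a · x ≡ false
⊥ˢ⇒⊥ {a = a} {U} (⊥ˢ-basis a⊥B) (c , refl) =
  trans (·-lincomb a c (basis U)) (trans (cong (c ·_) a⊥B) (·-zeroʳ c))

⊥⇒⊥ˢ : ∀ {a : Vect n} {U : Subspace n k} → (∀ {x} → x ∈S U → a · x ≡ false) → a ⊥ˢ U
⊥⇒⊥ˢ {a = a} {U} a⊥U =
  ⊥ˢ-basis (·-nondegenerate _ λ c → trans (sym (·-lincomb a c (basis U))) (a⊥U (c , refl)))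

directSum : (U : Subspace n k) (W : Subspace n m) → TrivInter U W → Subspace n (k + m)
directSum {k = k} {m = m} U W U∩W≡0 = subspace (basis U Vec.++ basis W) independent
  where
  independent : LinIndep (basis U Vec.++ basis W)
  independent c lincomb≡0 with cU , cW , refl ← Vec.splitAt k c =
    trans (cong₂ Vec._++_ cU≡0 cW≡0) (sym (replicate-++ k false))
    where
    u≡w : lincomb cU (basis U) ≡ lincomb cW (basis W)
    u≡w = ⊕≡0v⇒≡ _ _ (trans (sym (lincomb-++ cU cW (basis U) (basis W))) lincomb≡0)
    u≡0 : lincomb cU (basis U) ≡ 0v
    u≡0 = U∩W≡0 _ (cU , refl) (cW , sym u≡w)
    cU≡0 : cU ≡ replicate k false
    cU≡0 = indep U cU u≡0
    cW≡0 : cW ≡ replicate m false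
    cW≡0 = indep W cW (trans (sym u≡w) u≡0)

⊥ˢ-directSum : ∀ {a : Vect n} {U : Subspace n k} {W : Subspace n m} (U∩W≡0 : TrivInter U W) →
               a ⊥ˢ U → a ⊥ˢ W → a ⊥ˢ directSum U W U∩W≡0
⊥ˢ-directSum {k = k} {m = m} {a = a} {U} {W} _ (⊥ˢ-basis a⊥U) (⊥ˢ-basis a⊥W) = ⊥ˢ-basis (begin
  Vec.map (a ·_) (basis U Vec.++ basis W)                  ≡⟨ map-++ (a ·_) (basis U) (basis W) ⟩
  Vec.map (a ·_) (basis U) Vec.++ Vec.map (a ·_) (basis W)  ≡⟨ cong₂ Vec._++_ a⊥U a⊥W ⟩
  replicate k false Vec.++ replicate m false                ≡⟨ sym (replicate-++ k false) ⟩
  0v                                                        ∎)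
  where open ≡-Reasoning

-- Counting in F₂ⁿ

vecs : ∀ n → List (Vect n)
vecs zero    = [] ∷ []
vecs (suc n) = map (false ∷_) (vecs n) ++ map (true ∷_) (vecs n)

∈-vecs : ∀ (x : Vect n) → x ∈ vecs n
∈-vecs []                   = here refl
∈-vecs {suc n} (false ∷ x) = ∈-++⁺ˡ (∈-map⁺ (false ∷_) (∈-vecs x))
∈-vecs {suc n} (true  ∷ x) = ∈-++⁺ʳ (map (false ∷_) (vecs n)) (∈-map⁺ (true ∷_) (∈-vecs x))

vecs-unique : ∀ n → Unique (vecs n)
vecs-unique zero    = [] ∷ []
vecs-unique (suc n) = Unique.++⁺ (Unique.map⁺ ∷-injectiveʳ (vecs-unique n))
                                 (Unique.map⁺ ∷-injectiveʳ (vecs-unique n)) disjoint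
  where
  disjoint : ∀ {v} → ¬ (v ∈ map (false ∷_) (vecs n) × v ∈ map (true ∷_) (vecs n))
  disjoint (v∈F , v∈T) with ∈-map⁻ (false ∷_) v∈F | ∈-map⁻ (true ∷_) v∈T
  ... | _ , _ , refl | _ , _ , ()

nonzeroVecs : ∀ n → List (Vect n)
nonzeroVecs n = filter (λ x → ¬? (x ≟ᵛ 0v)) (vecs n)

∈-nonzeroVecs : ∀ {x : Vect n} → x ≢ 0v → x ∈ nonzeroVecs n
∈-nonzeroVecs x≢0 = ∈-filter⁺ (λ x → ¬? (x ≟ᵛ 0v)) (∈-vecs _) x≢0

nonzeroVecs-nonzero : ∀ {x : Vect n} → x ∈ nonzeroVecs n → x ≢ 0v
nonzeroVecs-nonzero {n} x∈ = proj₂ (∈-filter⁻ (λ x → ¬? (x ≟ᵛ 0v)) {xs = vecs n} x∈)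

nonzeroVecs-unique : ∀ n → Unique (nonzeroVecs n)
nonzeroVecs-unique n = Unique.filter⁺ (λ x → ¬? (x ≟ᵛ 0v)) (vecs-unique n)

-- Sums along an injection φ into F₂ⁿ are compared by counting preimages, of which there are at most one.
module Injection {L : List A} (L-unique : Unique L) (φ : A → Vect n)
                 (φ-injective : ∀ {y y'} → y ∈ L → y' ∈ L → φ y ≡ φ y' → y ≡ y') where

  preimages : Vect n → ℕ
  preimages x = ∑[ y ∈ L ] 𝟙 (does (φ y ≟ᵛ x))

  preimages≤1 : ∀ x → preimages x ≤ 1
  preimages≤1 x = ∑-≤1 {g = λ y → 𝟙 (does (φ y ≟ᵛ x))} L-unique (λ _ → 𝟙≤1 _)
    λ {y} {y'} y∈L y'∈L hit hit' →
      φ-injective y∈L y'∈L (trans (𝟙-does-positive (φ y ≟ᵛ x) hit) (sym (𝟙-does-positive (φ y' ≟ᵛ x) hit')))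

  ∑-pullback : ∀ q → ∑[ y ∈ L ] q (φ y) ≡ ∑[ x ∈ vecs n ] (q x * preimages x)
  ∑-pullback q = begin
    ∑[ y ∈ L ] q (φ y)
      ≡⟨ ∑-cong L (λ {y} _ → sym (∑-sift _≟ᵛ_ (vecs-unique n) (∈-vecs (φ y)) q)) ⟩
    ∑[ y ∈ L ] ∑[ x ∈ vecs n ] (𝟙 (does (φ y ≟ᵛ x)) * q x)
      ≡⟨ ∑-comm L (vecs n) (λ y x → 𝟙 (does (φ y ≟ᵛ x)) * q x) ⟩
    ∑[ x ∈ vecs n ] ∑[ y ∈ L ] (𝟙 (does (φ y ≟ᵛ x)) * q x)
      ≡⟨ ∑-cong (vecs n) (λ {x} _ → trans (∑-distribʳ-* L (q x) _) (*-comm _ (q x))) ⟩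
    ∑[ x ∈ vecs n ] (q x * preimages x) ∎
    where open ≡-Reasoning

  ∑-injection-≤ : ∀ q → ∑[ y ∈ L ] q (φ y) ≤ ∑[ x ∈ vecs n ] q x
  ∑-injection-≤ q = begin
    ∑[ y ∈ L ] q (φ y)                  ≡⟨ ∑-pullback q ⟩
    ∑[ x ∈ vecs n ] (q x * preimages x) ≤⟨ ∑-mono-≤ (vecs n) (λ {x} _ → *-monoʳ-≤ (q x) (preimages≤1 x)) ⟩
    ∑[ x ∈ vecs n ] (q x * 1)           ≡⟨ ∑-cong (vecs n) (λ {x} _ → *-identityʳ (q x)) ⟩
    ∑[ x ∈ vecs n ] q x                 ∎
    where open ≤-Reasoning

  ∑-injection-≡⇒onto : ∀ q → ∑[ y ∈ L ] q (φ y) ≡ ∑[ x ∈ vecs n ] q x →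
                       ∀ {x} → 0 < q x → ∃ λ y → y ∈ L × φ y ≡ x
  ∑-injection-≡⇒onto q ∑≡∑ {x} 0<qx =
    let y , y∈L , hit = ∑-positive L (λ y → 𝟙 (does (φ y ≟ᵛ x))) 0<preimages
    in y , y∈L , 𝟙-does-positive (φ y ≟ᵛ x) hit
    where
    fibre-full : q x * preimages x ≡ q x
    fibre-full = ∑-≤-≡⇒≡ (vecs n) (λ {x} _ → ≤-trans (*-monoʳ-≤ (q x) (preimages≤1 x)) (≤-reflexive (*-identityʳ (q x))))
                         (trans (sym (∑-pullback q)) ∑≡∑) (∈-vecs x)
    0<preimages : 0 < preimages x
    0<preimages = proj₂ (*-positive⁻ (q x) _ (subst (0 <_) (sym fibre-full) 0<qx))

[_⊥_] : Vect n → Vect n → ℕ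
[ a ⊥ x ] = 𝟙 (not (a · x))

-- The geometry of PG(6,2)

hyperplanes : List (Vect 7)
hyperplanes = nonzeroVecs 7

hyperplanes-through-point : ∀ {x} → x ∈ nonzeroVecs 7 → ∑[ a ∈ hyperplanes ] [ a ⊥ x ] ≡ 63
hyperplanes-through-point =
  All.lookup (toWitness {a? = all? (λ x → ∑[ a ∈ hyperplanes ] [ a ⊥ x ] ≟ 63) (nonzeroVecs 7)} _)

points-on-hyperplane : ∀ {a} → a ∈ hyperplanes → ∑[ x ∈ vecs 7 ] [ a ⊥ x ] ≡ 64
points-on-hyperplane =
  All.lookup (toWitness {a? = all? (λ a → ∑[ x ∈ vecs 7 ] [ a ⊥ x ] ≟ 64) hyperplanes} _)

-- With v the values of a normal vector on a basis of a plane: a plane meets a hyperplane in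
-- 3 points, or lies inside it (7 points).
plane-meets-hyperplane : ∀ (v : Vect 3) → ∑[ c ∈ nonzeroVecs 3 ] [ c ⊥ v ] ≡ 3 + 4 * 𝟙 (does (v ≟ᵛ 0v))
plane-meets-hyperplane v = All.lookup (toWitness {a? = all? count (vecs 3)} _) (∈-vecs v)
  where
  count : ∀ v → Dec (∑[ c ∈ nonzeroVecs 3 ] [ c ⊥ v ] ≡ 3 + 4 * 𝟙 (does (v ≟ᵛ 0v)))
  count v = ∑[ c ∈ nonzeroVecs 3 ] [ c ⊥ v ] ≟ 3 + 4 * 𝟙 (does (v ≟ᵛ 0v))

-- Inclusion–exclusion over the points x, y, x ⊕ y of the line through x and y.
hyperplanes-through-two-points : ∀ {x y} → x ∈ nonzeroVecs 7 → y ∈ nonzeroVecs 7 → x ≢ y →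
                                 ∑[ a ∈ hyperplanes ] ([ a ⊥ x ] * [ a ⊥ y ]) ≡ 31
hyperplanes-through-two-points {x} {y} x∈ y∈ x≢y = *-cancelˡ-≡ _ 31 2 (+-cancelˡ-≡ 127 _ _ (begin
  127 + 2 * ∑[ a ∈ hyperplanes ] ([ a ⊥ x ] * [ a ⊥ y ])
    ≡⟨ sym (∑-affine hyperplanes 1 2 (λ a → [ a ⊥ x ] * [ a ⊥ y ])) ⟩
  ∑[ a ∈ hyperplanes ] (1 + 2 * ([ a ⊥ x ] * [ a ⊥ y ]))
    ≡⟨ ∑-cong hyperplanes (λ {a} _ → pointwise a) ⟩
  ∑[ a ∈ hyperplanes ] ([ a ⊥ x ] + [ a ⊥ y ] + [ a ⊥ x ⊕ y ])
    ≡⟨ ∑-distrib-+ hyperplanes (λ a → [ a ⊥ x ] + [ a ⊥ y ]) (λ a → [ a ⊥ x ⊕ y ]) ⟩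
  ∑[ a ∈ hyperplanes ] ([ a ⊥ x ] + [ a ⊥ y ]) + ∑[ a ∈ hyperplanes ] [ a ⊥ x ⊕ y ]
    ≡⟨ cong (_+ ∑[ a ∈ hyperplanes ] [ a ⊥ x ⊕ y ])
            (∑-distrib-+ hyperplanes (λ a → [ a ⊥ x ]) (λ a → [ a ⊥ y ])) ⟩
  ∑[ a ∈ hyperplanes ] [ a ⊥ x ] + ∑[ a ∈ hyperplanes ] [ a ⊥ y ] + ∑[ a ∈ hyperplanes ] [ a ⊥ x ⊕ y ]
    ≡⟨ cong₂ _+_ (cong₂ _+_ (hyperplanes-through-point x∈) (hyperplanes-through-point y∈))
                 (hyperplanes-through-point (∈-nonzeroVecs (x≢y ∘ ⊕≡0v⇒≡ x y))) ⟩
  189 ∎))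
  where
  open ≡-Reasoning
  count : ∀ p q → 1 + 2 * (𝟙 (not p) * 𝟙 (not q)) ≡ 𝟙 (not p) + 𝟙 (not q) + 𝟙 (not (p xor q))
  count true  true  = refl
  count true  false = refl
  count false true  = refl
  count false false = refl
  pointwise : ∀ a → 1 + 2 * ([ a ⊥ x ] * [ a ⊥ y ]) ≡ [ a ⊥ x ] + [ a ⊥ y ] + [ a ⊥ x ⊕ y ]
  pointwise a rewrite ·-distribˡ-⊕ a x y = count (a · x) (a · y)

-- H ⊆ a⊥ and both have 2⁶ vectors.
kernel⊆hyperplane : ∀ {a} → a ∈ hyperplanes → (H : Hyperplane) → a ⊥ˢ H →
                    ∀ {x} → a · x ≡ false → x ∈S H
kernel⊆hyperplane {a} a∈ H a⊥H {x} a·x≡false =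
  let c , _ , c↦x = ∑-injection-≡⇒onto [ a ⊥_] sizes-agree (subst (λ b → 0 < 𝟙 (not b)) (sym a·x≡false) z<s)
  in c , c↦x
  where
  open Injection (vecs-unique 6) (λ c → lincomb c (basis H)) (λ {c} {d} _ _ → lincomb-injective (indep H) c d)
  sizes-agree : ∑[ c ∈ vecs 6 ] [ a ⊥ lincomb c (basis H) ] ≡ ∑[ x ∈ vecs 7 ] [ a ⊥ x ]
  sizes-agree = begin
    ∑[ c ∈ vecs 6 ] [ a ⊥ lincomb c (basis H) ]
      ≡⟨ ∑-cong (vecs 6) {h = λ _ → 1} (λ {c} _ → cong (𝟙 ∘ not) (⊥ˢ⇒⊥ a⊥H (c , refl))) ⟩
    ∑[ c ∈ vecs 6 ] 1
      ≡⟨ ∑-const (vecs 6) 1 ⟩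
    64
      ≡⟨ sym (points-on-hyperplane a∈) ⟩
    ∑[ x ∈ vecs 7 ] [ a ⊥ x ] ∎
    where open ≡-Reasoning

-- A partial spread of 17 planes

module PartialPlaneSpread (S : Fin 17 → Block) (S-spread : IsPartialPlaneSpread S) where

  point : Fin 17 → Vect 3 → Vect 7
  point i c = lincomb c (basis (S i))

  point-nonzero : ∀ i {c} → c ∈ nonzeroVecs 3 → point i c ≢ 0v
  point-nonzero i c∈ point≡0 = nonzeroVecs-nonzero c∈ (indep (S i) _ point≡0)

  point-of-other-block : ∀ {i j c d} → i ≢ j → c ∈ nonzeroVecs 3 → point i c ≢ point j d
  point-of-other-block {i} {j} {c} {d} i≢j c∈ eq =
    point-nonzero i c∈ (S-spread i j i≢j _ (c , refl) (d , sym eq))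

  points : List (Fin 17 × Vect 3)
  points = cartesianProduct (allFin 17) (nonzeroVecs 3)

  point-injective : ∀ {ic jd} → ic ∈ points → jd ∈ points → uncurry point ic ≡ uncurry point jd → ic ≡ jd
  point-injective {i , c} {j , d} ic∈ _ eq with i ≟ᶠ j
  ... | yes refl = cong (i ,_) (lincomb-injective (indep (S i)) c d eq)
  ... | no  i≢j  = contradiction eq
    (point-of-other-block {d = d} i≢j (proj₂ (∈-cartesianProduct⁻ (allFin 17) (nonzeroVecs 3) ic∈)))

  inc : Fin 17 → Vect 7 → ℕ
  inc i a = 𝟙 (does (a ⊥ˢ? S i))

  blocksIn : Vect 7 → ℕ
  blocksIn a = ∑[ i ∈ allFin 17 ] inc i a

  common : Fin 17 → Fin 17 → ℕ
  common i j = ∑[ a ∈ hyperplanes ] (inc i a * inc j a)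

  pointsIn : Fin 17 → Vect 7 → ℕ
  pointsIn i a = ∑[ c ∈ nonzeroVecs 3 ] [ a ⊥ point i c ]

  pointsIn≡ : ∀ i a → pointsIn i a ≡ 3 + 4 * inc i a
  pointsIn≡ i a = trans (∑-cong (nonzeroVecs 3) {h = λ c → [ c ⊥ values ]}
                                  (λ {c} _ → cong (𝟙 ∘ not) (·-lincomb a c (basis (S i)))))
                        (plane-meets-hyperplane values)
    where
    values = Vec.map (a ·_) (basis (S i))

  ∑-pointsIn : ∀ i → ∑[ a ∈ hyperplanes ] pointsIn i a ≡ 441
  ∑-pointsIn i = begin
    ∑[ a ∈ hyperplanes ] ∑[ c ∈ nonzeroVecs 3 ] [ a ⊥ point i c ]
      ≡⟨ ∑-comm hyperplanes (nonzeroVecs 3) (λ a c → [ a ⊥ point i c ]) ⟩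
    ∑[ c ∈ nonzeroVecs 3 ] ∑[ a ∈ hyperplanes ] [ a ⊥ point i c ]
      ≡⟨ ∑-cong (nonzeroVecs 3) (λ c∈ → hyperplanes-through-point (∈-nonzeroVecs (point-nonzero i c∈))) ⟩
    ∑[ c ∈ nonzeroVecs 3 ] 63
      ≡⟨ ∑-const (nonzeroVecs 3) 63 ⟩
    441 ∎
    where open ≡-Reasoning

  ∑-inc : ∀ i → ∑[ a ∈ hyperplanes ] inc i a ≡ 15
  ∑-inc i = *-cancelˡ-≡ _ 15 4 (+-cancelˡ-≡ 381 _ _ (begin
    381 + 4 * ∑[ a ∈ hyperplanes ] inc i a  ≡⟨ sym (∑-affine hyperplanes 3 4 (inc i)) ⟩
    ∑[ a ∈ hyperplanes ] (3 + 4 * inc i a)  ≡⟨ ∑-cong hyperplanes (λ {a} _ → sym (pointsIn≡ i a)) ⟩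
    ∑[ a ∈ hyperplanes ] pointsIn i a       ≡⟨ ∑-pointsIn i ⟩
    441                                     ∎))
    where open ≡-Reasoning

  -- The 17 planes have disjoint sets of points, and a hyperplane has only 64 vectors.
  blocksIn<4 : ∀ {a} → a ∈ hyperplanes → blocksIn a < 4
  blocksIn<4 {a} a∈ = *-cancelˡ-< 4 _ 4 (+-cancelˡ-< 51 _ _ (≤-<-trans bound (m≤m+n 65 2)))
    where
    open ≤-Reasoning
    open Injection (Unique.cartesianProduct⁺ (Unique.allFin⁺ 17) (nonzeroVecs-unique 3))
                   (uncurry point) point-injective
    bound : 51 + 4 * blocksIn a ≤ 64
    bound = begin
      51 + 4 * blocksIn a
        ≡⟨ sym (∑-affine (allFin 17) 3 4 (λ i → inc i a)) ⟩
      ∑[ i ∈ allFin 17 ] (3 + 4 * inc i a)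
        ≡⟨ ∑-cong (allFin 17) (λ {i} _ → sym (pointsIn≡ i a)) ⟩
      ∑[ i ∈ allFin 17 ] pointsIn i a
        ≡⟨ sym (∑-cartesianProduct (allFin 17) (nonzeroVecs 3) (λ (i , c) → [ a ⊥ point i c ])) ⟩
      ∑[ ic ∈ points ] [ a ⊥ uncurry point ic ]
        ≤⟨ ∑-injection-≤ [ a ⊥_] ⟩
      ∑[ x ∈ vecs 7 ] [ a ⊥ x ]
        ≡⟨ points-on-hyperplane a∈ ⟩
      64 ∎

  ∑-pointsIn-product : ∀ {i j} → i ≢ j → ∑[ a ∈ hyperplanes ] (pointsIn i a * pointsIn j a) ≡ 1519
  ∑-pointsIn-product {i} {j} i≢j = begin
    ∑[ a ∈ hyperplanes ] (pointsIn i a * pointsIn j a)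
      ≡⟨ ∑-cong hyperplanes (λ {a} _ → ∑*∑ C C (λ c → [ a ⊥ point i c ]) (λ d → [ a ⊥ point j d ])) ⟩
    ∑[ a ∈ hyperplanes ] ∑[ c ∈ C ] ∑[ d ∈ C ] ([ a ⊥ point i c ] * [ a ⊥ point j d ])
      ≡⟨ ∑-comm hyperplanes C (λ a c → ∑[ d ∈ C ] ([ a ⊥ point i c ] * [ a ⊥ point j d ])) ⟩
    ∑[ c ∈ C ] ∑[ a ∈ hyperplanes ] ∑[ d ∈ C ] ([ a ⊥ point i c ] * [ a ⊥ point j d ])
      ≡⟨ ∑-cong C (λ {c} _ → ∑-comm hyperplanes C (λ a d → [ a ⊥ point i c ] * [ a ⊥ point j d ])) ⟩
    ∑[ c ∈ C ] ∑[ d ∈ C ] ∑[ a ∈ hyperplanes ] ([ a ⊥ point i c ] * [ a ⊥ point j d ])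
      ≡⟨ ∑-cong C (λ c∈ → ∑-cong C (λ {d} d∈ → hyperplanes-through-two-points
           (∈-nonzeroVecs (point-nonzero i c∈)) (∈-nonzeroVecs (point-nonzero j d∈))
           (point-of-other-block {d = d} i≢j c∈))) ⟩
    ∑[ c ∈ C ] ∑[ d ∈ C ] 31
      ≡⟨ ∑-cong C (λ _ → ∑-const C 31) ⟩
    ∑[ c ∈ C ] 217
      ≡⟨ ∑-const C 217 ⟩
    1519 ∎
    where
    open ≡-Reasoning
    C = nonzeroVecs 3

  ∑-pointsIn-product-expanded : ∀ i j →
                                ∑[ a ∈ hyperplanes ] (pointsIn i a * pointsIn j a) ≡ 1503 + 16 * common i j
  ∑-pointsIn-product-expanded i j = begin
    ∑[ a ∈ hyperplanes ] (pointsIn i a * pointsIn j a)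
      ≡⟨ ∑-cong hyperplanes {h = λ a → 9 + 4 * g a}
                (λ {a} _ → trans (cong₂ _*_ (pointsIn≡ i a) (pointsIn≡ j a)) (expand (inc i a) (inc j a))) ⟩
    ∑[ a ∈ hyperplanes ] (9 + 4 * g a)
      ≡⟨ ∑-affine hyperplanes 9 4 g ⟩
    127 * 9 + 4 * ∑ hyperplanes g
      ≡⟨ cong (λ s → 127 * 9 + 4 * s) ∑g ⟩
    127 * 9 + 4 * (3 * (15 + 15) + 4 * common i j)
      ≡⟨ collect (common i j) ⟩
    1503 + 16 * common i j ∎
    where
    open ≡-Reasoning
    g : Vect 7 → ℕ
    g a = 3 * (inc i a + inc j a) + 4 * (inc i a * inc j a)
    ∑g : ∑ hyperplanes g ≡ 3 * (15 + 15) + 4 * common i j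
    ∑g = trans (∑-distrib-+ hyperplanes (λ a → 3 * (inc i a + inc j a)) (λ a → 4 * (inc i a * inc j a)))
               (cong₂ _+_ (trans (∑-distribˡ-* hyperplanes 3 (λ a → inc i a + inc j a))
                                 (cong (3 *_) (trans (∑-distrib-+ hyperplanes (inc i) (inc j))
                                                     (cong₂ _+_ (∑-inc i) (∑-inc j)))))
                          (∑-distribˡ-* hyperplanes 4 (λ a → inc i a * inc j a)))
    expand : ∀ x y → (3 + 4 * x) * (3 + 4 * y) ≡ 9 + 4 * (3 * (x + y) + 4 * (x * y))
    expand = solve-∀
    collect : ∀ x → 127 * 9 + 4 * (3 * (15 + 15) + 4 * x) ≡ 1503 + 16 * x
    collect = solve-∀

  common≡1 : ∀ {i j} → i ≢ j → common i j ≡ 1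
  common≡1 {i} {j} i≢j = *-cancelˡ-≡ _ 1 16 (+-cancelˡ-≡ 1503 _ _
    (trans (sym (∑-pointsIn-product-expanded i j)) (∑-pointsIn-product i≢j)))

  common≡ : ∀ i j → common i j ≡ 1 + 𝟙 (does (i ≟ᶠ j)) * 14
  common≡ i j with i ≟ᶠ j
  ... | yes refl = trans (∑-cong hyperplanes (λ {a} _ → 𝟙*𝟙 (does (a ⊥ˢ? S i)))) (∑-inc i)
  ... | no  i≢j  = common≡1 i≢j

  common-hyperplane-unique : ∀ {i j a a'} → i ≢ j → a ∈ hyperplanes → a' ∈ hyperplanes →
                             a ⊥ˢ S i → a ⊥ˢ S j → a' ⊥ˢ S i → a' ⊥ˢ S j → a ≡ a'
  common-hyperplane-unique {i} {j} {a} {a'} i≢j a∈ a'∈ a⊥i a⊥j a'⊥i a'⊥j with a ≟ᵛ a'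
  ... | yes a≡a' = a≡a'
  ... | no  a≢a' = contradiction (sym (common≡1 i≢j)) (<⇒≢ (two-positive⇒∑≥2 {g = λ b → inc i b * inc j b}
                     (nonzeroVecs-unique 7) a∈ a'∈ a≢a' (positive a⊥i a⊥j) (positive a'⊥i a'⊥j)))
    where
    positive : ∀ {b} → b ⊥ˢ S i → b ⊥ˢ S j → 0 < inc i b * inc j b
    positive {b} b⊥i b⊥j rewrite dec-true (b ⊥ˢ? S i) b⊥i | dec-true (b ⊥ˢ? S j) b⊥j = z<s

  ∑-blocksIn : ∑[ a ∈ hyperplanes ] blocksIn a ≡ 255
  ∑-blocksIn = trans (∑-comm hyperplanes (allFin 17) (λ a i → inc i a))
                     (trans (∑-cong (allFin 17) (λ {i} _ → ∑-inc i)) (∑-const (allFin 17) 15))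

  ∑-common : ∀ i → ∑[ j ∈ allFin 17 ] common i j ≡ 31
  ∑-common i = begin
    ∑[ j ∈ allFin 17 ] common i j
      ≡⟨ ∑-cong (allFin 17) (λ {j} _ → common≡ i j) ⟩
    ∑[ j ∈ allFin 17 ] (1 + 𝟙 (does (i ≟ᶠ j)) * 14)
      ≡⟨ ∑-distrib-+ (allFin 17) (λ _ → 1) (λ j → 𝟙 (does (i ≟ᶠ j)) * 14) ⟩
    ∑[ j ∈ allFin 17 ] 1 + ∑[ j ∈ allFin 17 ] (𝟙 (does (i ≟ᶠ j)) * 14)
      ≡⟨ cong₂ _+_ (∑-const (allFin 17) 1) (∑-sift _≟ᶠ_ (Unique.allFin⁺ 17) (∈-allFin i) (λ _ → 14)) ⟩
    31 ∎
    where open ≡-Reasoning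

  ∑-blocksIn² : ∑[ a ∈ hyperplanes ] (blocksIn a * blocksIn a) ≡ 527
  ∑-blocksIn² = begin
    ∑[ a ∈ hyperplanes ] (blocksIn a * blocksIn a)
      ≡⟨ ∑-cong hyperplanes (λ {a} _ → ∑*∑ (allFin 17) (allFin 17) (λ i → inc i a) (λ j → inc j a)) ⟩
    ∑[ a ∈ hyperplanes ] ∑[ i ∈ allFin 17 ] ∑[ j ∈ allFin 17 ] (inc i a * inc j a)
      ≡⟨ ∑-comm hyperplanes (allFin 17) (λ a i → ∑[ j ∈ allFin 17 ] (inc i a * inc j a)) ⟩
    ∑[ i ∈ allFin 17 ] ∑[ a ∈ hyperplanes ] ∑[ j ∈ allFin 17 ] (inc i a * inc j a)
      ≡⟨ ∑-cong (allFin 17) (λ {i} _ → ∑-comm hyperplanes (allFin 17) (λ a j → inc i a * inc j a)) ⟩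
    ∑[ i ∈ allFin 17 ] ∑[ j ∈ allFin 17 ] common i j
      ≡⟨ ∑-cong (allFin 17) {h = λ _ → 31} (λ {i} _ → ∑-common i) ⟩
    ∑[ i ∈ allFin 17 ] 31
      ≡⟨ ∑-const (allFin 17) 31 ⟩
    527 ∎
    where open ≡-Reasoning

  full : Vect 7 → ℕ
  full a = 𝟙 (does (blocksIn a ≟ 3))

  -- For n ≤ 3, n² ≤ 2n + 3·[n = 3]; so 527 ≤ 2 · 255 + 3 · (number of full hyperplanes).
  six≤∑full : 6 ≤ ∑[ a ∈ hyperplanes ] full a
  six≤∑full = *-cancelˡ-< 3 5 _ (+-cancelˡ-< 510 _ _ (<-≤-trans (m≤m+n 526 1) (begin
    527
      ≡⟨ sym ∑-blocksIn² ⟩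
    ∑[ a ∈ hyperplanes ] (blocksIn a * blocksIn a)
      ≤⟨ ∑-mono-≤ hyperplanes (λ a∈ → square-bound (blocksIn<4 a∈)) ⟩
    ∑[ a ∈ hyperplanes ] (2 * blocksIn a + 3 * full a)
      ≡⟨ ∑-distrib-+ hyperplanes (λ a → 2 * blocksIn a) (λ a → 3 * full a) ⟩
    ∑[ a ∈ hyperplanes ] (2 * blocksIn a) + ∑[ a ∈ hyperplanes ] (3 * full a)
      ≡⟨ cong₂ _+_ (trans (∑-distribˡ-* hyperplanes 2 blocksIn) (cong (2 *_) ∑-blocksIn))
                   (∑-distribˡ-* hyperplanes 3 full) ⟩
    510 + 3 * ∑ hyperplanes full ∎)))
    where
    open ≤-Reasoning
    square-bound : ∀ {n} → n < 4 → n * n ≤ 2 * n + 3 * 𝟙 (does (n ≟ 3))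
    square-bound {0} _ = z≤n
    square-bound {1} _ = s≤s z≤n
    square-bound {2} _ = ≤-refl
    square-bound {3} _ = ≤-refl
    square-bound {suc (suc (suc (suc _)))} (s≤s (s≤s (s≤s (s≤s ()))))

  record FullHyperplaneThrough (i : Fin 17) : Set where
    field
      normal   : Vect 7
      nonzero  : normal ∈ hyperplanes
      is-full  : blocksIn normal ≡ 3
      contains : normal ⊥ˢ S i

  open FullHyperplaneThrough

  -- Counting incidences between blocks and full hyperplanes: 3 · 6 > 17.
  block-in-two-full-hyperplanes : ∃ λ i → Σ (FullHyperplaneThrough i) λ F → Σ (FullHyperplaneThrough i) λ F' →
                                  normal F ≢ normal F'
  block-in-two-full-hyperplanes =
    let i , _ , 2≤ = pigeonhole (allFin 17) fullThrough 17<∑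
        a , a' , a∈ , a'∈ , a≢a' , 0<a , 0<a' = ∑≥2⇒two-positive {g = λ a → full a * inc i a}
          (nonzeroVecs-unique 7) (λ {a} _ → *-mono-≤ (𝟙≤1 (does (blocksIn a ≟ 3))) (𝟙≤1 (does (a ⊥ˢ? S i)))) 2≤
    in i , through a∈ 0<a , through a'∈ 0<a' , a≢a'
    where
    fullThrough : Fin 17 → ℕ
    fullThrough i = ∑[ a ∈ hyperplanes ] (full a * inc i a)
    full*blocksIn : ∀ n → 𝟙 (does (n ≟ 3)) * n ≡ 3 * 𝟙 (does (n ≟ 3))
    full*blocksIn 0 = refl
    full*blocksIn 1 = refl
    full*blocksIn 2 = refl
    full*blocksIn 3 = refl
    full*blocksIn (suc (suc (suc (suc _)))) = refl
    17<∑ : 17 < ∑[ i ∈ allFin 17 ] fullThrough i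
    17<∑ = begin-strict
      17
        <⟨ n<1+n 17 ⟩
      3 * 6
        ≤⟨ *-monoʳ-≤ 3 six≤∑full ⟩
      3 * ∑ hyperplanes full
        ≡⟨ sym (∑-distribˡ-* hyperplanes 3 full) ⟩
      ∑[ a ∈ hyperplanes ] (3 * full a)
        ≡⟨ ∑-cong hyperplanes (λ {a} _ → sym (full*blocksIn (blocksIn a))) ⟩
      ∑[ a ∈ hyperplanes ] (full a * blocksIn a)
        ≡⟨ ∑-cong hyperplanes (λ {a} _ → sym (∑-distribˡ-* (allFin 17) (full a) (λ i → inc i a))) ⟩
      ∑[ a ∈ hyperplanes ] ∑[ i ∈ allFin 17 ] (full a * inc i a)
        ≡⟨ ∑-comm hyperplanes (allFin 17) (λ a i → full a * inc i a) ⟩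
      ∑[ i ∈ allFin 17 ] fullThrough i ∎
      where open ≤-Reasoning
    through : ∀ {i a} → a ∈ hyperplanes → 0 < full a * inc i a → FullHyperplaneThrough i
    through {i} {a} a∈ 0<full*inc = let 0<full , 0<inc = *-positive⁻ (full a) (inc i a) 0<full*inc in record
      { normal   = a
      ; nonzero  = a∈
      ; is-full  = 𝟙-does-positive (blocksIn a ≟ 3) 0<full
      ; contains = 𝟙-does-positive (a ⊥ˢ? S i) 0<inc
      }

  record TwoMoreBlocks (i : Fin 17) (a : Vect 7) : Set where
    field
      p q : Fin 17
      p≢q : p ≢ q
      i≢p : i ≢ p
      i≢q : i ≢ q
      a⊥p : a ⊥ˢ S p
      a⊥q : a ⊥ˢ S q

  two-more-blocks : ∀ {i} (F : FullHyperplaneThrough i) → TwoMoreBlocks i (normal F)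
  two-more-blocks {i} F =
    let p , q , _ , _ , p≢q , 0<p , 0<q = ∑≥2⇒two-positive {g = other} (Unique.allFin⁺ 17)
          (λ {j} _ → *-mono-≤ (𝟙≤1 (not (does (i ≟ᶠ j)))) (𝟙≤1 (does (a ⊥ˢ? S j)))) (≤-reflexive (sym two-others))
        i≢p , a⊥p = split 0<p
        i≢q , a⊥q = split 0<q
    in record { p = p ; q = q ; p≢q = p≢q ; i≢p = i≢p ; i≢q = i≢q ; a⊥p = a⊥p ; a⊥q = a⊥q }
    where
    a = normal F
    other : Fin 17 → ℕ
    other j = 𝟙 (not (does (i ≟ᶠ j))) * inc j a
    two-others : ∑[ j ∈ allFin 17 ] other j ≡ 2
    two-others = +-cancelˡ-≡ 1 _ _ (begin
      1 + ∑[ j ∈ allFin 17 ] other j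
        ≡⟨ cong (λ b → 𝟙 b + ∑[ j ∈ allFin 17 ] other j) (sym (dec-true (a ⊥ˢ? S i) (contains F))) ⟩
      inc i a + ∑[ j ∈ allFin 17 ] other j
        ≡⟨ sym (∑-remove _≟ᶠ_ (Unique.allFin⁺ 17) (∈-allFin i) (λ j → inc j a)) ⟩
      blocksIn a
        ≡⟨ is-full F ⟩
      3 ∎)
      where open ≡-Reasoning
    split : ∀ {j} → 0 < other j → i ≢ j × a ⊥ˢ S j
    split {j} 0<other =
      let 0<[i≢j] , 0<inc = *-positive⁻ (𝟙 (not (does (i ≟ᶠ j)))) (inc j a) 0<other
      in 𝟙-not-does-positive (i ≟ᶠ j) 0<[i≢j] , 𝟙-does-positive (a ⊥ˢ? S j) 0<inc

  -- p, q, r, s are new blocks because i and any other block lie in only one common hyperplane.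
  five-configuration : ∀ {i} (F F' : FullHyperplaneThrough i) → normal F ≢ normal F' →
                       Contains5Configuration S
  five-configuration {i} F F' a≢a' =
    Vec.lookup five , lookup-injective distinct ,
    (λ u v u≢v → S-spread _ _ (u≢v ∘ lookup-injective distinct)) ,
    H , H' , H≉H' ,
    (_↑ˡ 2 , ↑ˡ-injective 2 _ _ , λ { zero → ⊆H a⊥p ; (suc zero) → ⊆H a⊥q ; (suc (suc zero)) → ⊆H a⊥i }) ,
    (2 ↑ʳ_ , ↑ʳ-injective 2 _ _ , λ { zero → ⊆H' a'⊥i ; (suc zero) → ⊆H' a'⊥r ; (suc (suc zero)) → ⊆H' a'⊥s })
    where
    open FullHyperplaneThrough F using () renaming (normal to a; nonzero to a∈; contains to a⊥i)
    open FullHyperplaneThrough F' using () renaming (normal to a'; nonzero to a'∈; contains to a'⊥i)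
    open TwoMoreBlocks (two-more-blocks F)
    open TwoMoreBlocks (two-more-blocks F')
      renaming (p to r; q to s; p≢q to r≢s; i≢p to i≢r; i≢q to i≢s; a⊥p to a'⊥r; a⊥q to a'⊥s)

    five : Vec (Fin 17) 5
    five = p ∷ q ∷ i ∷ r ∷ s ∷ []

    p∩i≡0 : TrivInter (S p) (S i)
    p∩i≡0 = S-spread p i (i≢p ∘ sym)

    H : Hyperplane
    H = directSum (S p) (S i) p∩i≡0

    H' : Hyperplane
    H' = directSum (S i) (S r) (S-spread i r i≢r)

    ⊆H : ∀ {j} → a ⊥ˢ S j → S j ⊆S H
    ⊆H a⊥j _ x∈ = kernel⊆hyperplane a∈ H (⊥ˢ-directSum p∩i≡0 a⊥p a⊥i) (⊥ˢ⇒⊥ a⊥j x∈)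

    ⊆H' : ∀ {j} → a' ⊥ˢ S j → S j ⊆S H'
    ⊆H' a'⊥j _ x∈ = kernel⊆hyperplane a'∈ H' (⊥ˢ-directSum (S-spread i r i≢r) a'⊥i a'⊥r) (⊥ˢ⇒⊥ a'⊥j x∈)

    not-in-both : ∀ {j k} → a ⊥ˢ S j → a' ⊥ˢ S k → i ≢ k → j ≢ k
    not-in-both a⊥j a'⊥k i≢k refl = a≢a' (common-hyperplane-unique i≢k a∈ a'∈ a⊥i a⊥j a'⊥i a'⊥k)

    distinct : AllPairs _≢_ five
    distinct = (p≢q ∷ (i≢p ∘ sym) ∷ not-in-both a⊥p a'⊥r i≢r ∷ not-in-both a⊥p a'⊥s i≢s ∷ [])
             ∷ ((i≢q ∘ sym) ∷ not-in-both a⊥q a'⊥r i≢r ∷ not-in-both a⊥q a'⊥s i≢s ∷ [])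
             ∷ (i≢r ∷ i≢s ∷ [])
             ∷ (r≢s ∷ [])
             ∷ []
             ∷ []

    H≉H' : ¬ (H ≈S H')
    H≉H' (_ , H'⊆H) = not-in-both (⊥⇒⊥ˢ λ x∈r → ⊥ˢ⇒⊥ a⊥H (H'⊆H _ (⊆H' a'⊥r _ x∈r))) a'⊥r i≢r refl
      where
      a⊥H : a ⊥ˢ H
      a⊥H = ⊥ˢ-directSum p∩i≡0 a⊥p a⊥i

lemma3p5 : (S : Fin 17 → Block) → IsPartialPlaneSpread S → Contains5Configuration S
lemma3p5 S S-spread =
  let _ , F , F' , F≢F' = block-in-two-full-hyperplanes in five-configuration F F' F≢F'
  where open PartialPlaneSpread S S-spread
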